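{- For every integer $n\geq 2$, the set $\mathcal{F}_n$ of split words of the $2$-states of the $n$-foil $F_n$ is \[ \mathcal{F}_n=\left\{1^p01^k01^{n-p-k-2}\;\middle|\; 0\leq p\leq n-2,\ 0\leq k\leq n-p-2\right\}\cup\left\{1^n\right\}. \]
   Context: A shadow diagram is a finite collection of closed curves in the plane whose only self-intersections are transverse double points (crossings). Its complementary regions can be checkerboard colored; at each crossing two opposite corners have one color and the other two the other color. $A$-regions are those in the color class of the unbounded region, $B$-regions the others. The $A$-split of a crossing is the smoothing (replacement of a neighborhood by two disjoint arcs) merging the two opposite $A$-corners; the $B$-split merges the two opposite $B$-corners. A state is obtained by choosing a split at every crossing; it is a disjoint union of simple closed curves, and a $2$-state is a state with exactly $2$ curves. With the crossings labelled $1,\dots,n$, the split word of a state is $w_1\cdots w_n$ with $w_i=0$ if an $A$-split is applied at crossing $i$ and $w_i=1$ if a $B$-split is applied. The $n$-foil $F_n$ is the shadow diagram given in polar coordinates by the union of the two curves $r=2+\cos(n\theta/2)$ and $r=2-\cos(n\theta/2)$, $\theta\in[0,2\pi]$ (the closed $2$-strand braid with $n$ crossings drawn around an annulus, the unbounded region and the central disc being opposite at every crossing), with its $n$ crossings labelled $1,\dots,n$ in order around the annulus. For a digit $\sigma$, $\sigma^k$ is the word of $k$ copies of $\sigma$ (empty if $k\leq 0$). -}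

module Defs where

open import Data.Nat using (ℕ; zero; suc)
open import Data.Nat.DivMod using (_mod_)
open import Data.Fin using (Fin; toℕ)
open import Data.Bool using (Bool)
open import Data.List using (List; tabulate)
open import Data.Product using (Σ; _×_; _,_)
open import Data.Sum using (_⊎_)
open import Relation.Nullary using (¬_)
open import Relation.Binary.PropositionalEquality using (_≡_)
open import Relation.Binary.Construct.Closure.Equivalence using (EqClosure)

-- Combinatorial model of the n-foil F_n (closed 2-strand braid with n crossings).
-- Crossings: Fin n, labelled in order around the annulus.
-- Between crossing i and crossing (next i) lies the bigon i, bounded by two
-- diagram edges: its outer edge (i , outer) and its inner edge (i , inner).
-- Regions: unbounded region and central disc are A-regions; the n bigons are B-regions.

next : ∀ {n} → Fin n → Fin n
next {suc m} i = suc (toℕ i) mod suc m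

data Side : Set where
  outer inner : Side

Edge : ℕ → Set
Edge n = Σ (Fin n) (λ _ → Side)

data Split : Set where
  A B : Split

State : ℕ → Set
State n = Fin n → Split

digit : Split → ℕ
digit A = 0
digit B = 1

splitWord : ∀ {n} → State n → List ℕ
splitWord s = tabulate (λ i → digit (s i))

-- At crossing j the four edge ends are
--   outer-left  = end of (i , outer),  inner-left  = end of (i , inner)   where next i = j,
--   outer-right = end of (j , outer),  inner-right = end of (j , inner).
-- Corners at j: outer region (between outer-left/outer-right), central disc
-- (inner-left/inner-right), bigon i (outer-left/inner-left), bigon j (outer-right/inner-right).
-- A-split (merge outer region and central disc corners): arcs outer-left–inner-left and
--   outer-right–inner-right.
-- B-split (merge the two bigon corners): arcs outer-left–outer-right and inner-left–inner-right.
data Arc {n : ℕ} (s : State n) : Edge n → Edge n → Set where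
  A-left  : ∀ i → s (next i) ≡ A → Arc s (i , outer) (i , inner)
  A-right : ∀ j → s j ≡ A → Arc s (j , outer) (j , inner)
  B-outer : ∀ i → s (next i) ≡ B → Arc s (i , outer) (next i , outer)
  B-inner : ∀ i → s (next i) ≡ B → Arc s (i , inner) (next i , inner)

SameCurve : ∀ {n} → State n → Edge n → Edge n → Set
SameCurve s = EqClosure (Arc s)

IsTwoState : ∀ {n} → State n → Set
IsTwoState {n} s =
  Σ (Edge n) λ u → Σ (Edge n) λ v →
    ¬ SameCurve s u v × ((w : Edge n) → SameCurve s w u ⊎ SameCurve s w v)

SplitWordOf2State : ℕ → List ℕ → Set
SplitWordOf2State n w = Σ (State n) λ s → IsTwoState s × splitWord s ≡ w

-- A curve of a state can switch between outer and inner edges only at an A-split, so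
-- with no A-split the state consists of the outer and the inner circle.  Otherwise,
-- walking backwards along B-splits, every edge reaches the outer edge just after some
-- A-split crossing; and for A-split crossings x < y, lying at a position in [x, y) is
-- invariant along curves, so distinct A-split crossings lie on distinct curves.  Hence
-- the 2-states are exactly the states with no A-split or with exactly two, whose split
-- words are read off directly.
module Submission where

open import Defs
open import Data.Nat as ℕ using (ℕ; zero; suc; _+_; _∸_; _≤_; _<_; s≤s)
open import Data.Nat.Properties as ℕ
  using (+-assoc; +-suc; m≤n+m; m∸n+n≡m; m+[n∸m]≡n; ∸-+-assoc; m+n≤o⇒m≤o∸n; m≤o∸n⇒m+n≤o;
         m≤n⇒m<n∨m≡n; ≤∧≢⇒<; m≤n⇒m≤1+n; m<1+n⇒m≤n; <⇒≤; <⇒≢)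
open import Data.Nat.DivMod using (_mod_; _%_; m<n⇒m%n≡m; m%n<n; %-distribˡ-+; m%n%n≡m%n; [m+n]%n≡m%n; n%n≡0)
open import Data.Nat.Tactic.RingSolver using (solve-∀)
open import Data.Fin as Fin using (Fin; toℕ; fromℕ<)
open import Data.Fin.Properties as Fin using (toℕ-injective; toℕ-fromℕ<; toℕ<n; any?)
open import Data.List using (List; _∷_; _++_; replicate; tabulate; applyUpTo)
open import Data.List.Properties using (tabulate-cong)
open import Data.Product using (Σ; _×_; _,_; proj₂; ∃)
open import Data.Sum as Sum using (_⊎_; inj₁; inj₂)
open import Data.Empty using (⊥; ⊥-elim)
open import Function using (_∘_; id)
open import Function.Construct.Identity using (⇔-id)
open import Function.Bundles using (_⇔_; mk⇔; Equivalence)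
open import Function.Properties.Equivalence using (⇔-isEquivalence)
open import Level using (Level)
open import Relation.Binary using (Setoid; tri<; tri≈; tri>)
open import Relation.Binary.PropositionalEquality
open import Relation.Binary.Construct.Closure.Equivalence as EqClosure using (gfold; symmetric)
open import Relation.Binary.Construct.Closure.ReflexiveTransitive using (ε; _◅_; _◅◅_)
open import Relation.Binary.Construct.Closure.Symmetric using (fwd; bwd)
open import Relation.Nullary using (¬_; Dec; yes; no; ¬?; _×-dec_; _⊎-dec_)
open import Relation.Nullary.Decidable using (decidable-stable)
open import Relation.Unary using (Pred; Decidable)

private
  variable
    a ℓ : Level
    n : ℕ

tabulate-toℕ : ∀ {A : Set a} n (f : ℕ → A) → tabulate {n = n} (f ∘ toℕ) ≡ applyUpTo f n
tabulate-toℕ zero    f = refl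
tabulate-toℕ (suc n) f = cong (f 0 ∷_) (tabulate-toℕ n (f ∘ suc))

applyUpTo-const : ∀ {A : Set a} (x : A) n → applyUpTo (λ _ → x) n ≡ replicate n x
applyUpTo-const x zero    = refl
applyUpTo-const x (suc n) = cong (x ∷_) (applyUpTo-const x n)

module _ (S : Setoid a ℓ) where
  open Setoid S using (_≈_) renaming (trans to ≈-trans; sym to ≈-sym)

  no-three-apart-in-two-classes : ∀ {u v x y z} →
    x ≈ u ⊎ x ≈ v → y ≈ u ⊎ y ≈ v → z ≈ u ⊎ z ≈ v →
    ¬ x ≈ y → ¬ y ≈ z → ¬ x ≈ z → ⊥
  no-three-apart-in-two-classes (inj₁ p) (inj₁ q) _ x≉y _ _ = x≉y (≈-trans p (≈-sym q))
  no-three-apart-in-two-classes (inj₂ p) (inj₂ q) _ x≉y _ _ = x≉y (≈-trans p (≈-sym q))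
  no-three-apart-in-two-classes (inj₁ p) _ (inj₁ q) _ _ x≉z = x≉z (≈-trans p (≈-sym q))
  no-three-apart-in-two-classes (inj₂ p) _ (inj₂ q) _ _ x≉z = x≉z (≈-trans p (≈-sym q))
  no-three-apart-in-two-classes _ (inj₁ p) (inj₁ q) _ y≉z _ = y≉z (≈-trans p (≈-sym q))
  no-three-apart-in-two-classes _ (inj₂ p) (inj₂ q) _ y≉z _ = y≉z (≈-trans p (≈-sym q))

_≟ₛ_ : (x y : Split) → Dec (x ≡ y)
A ≟ₛ A = yes refl
A ≟ₛ B = no λ ()
B ≟ₛ A = no λ ()
B ≟ₛ B = yes refl

≢A⇒≡B : ∀ {x} → x ≢ A → x ≡ B
≢A⇒≡B {A} x≢A = ⊥-elim (x≢A refl)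
≢A⇒≡B {B} _   = refl

≡A-ext : ∀ {x y} → (x ≡ A → y ≡ A) → (y ≡ A → x ≡ A) → x ≡ y
≡A-ext {A} x⇒y _ = sym (x⇒y refl)
≡A-ext {B} {A} _ y⇒x with y⇒x refl
... | ()
≡A-ext {B} {B} _ _ = refl

splitWord-cong : {s s′ : State n} → s ≗ s′ → splitWord s ≡ splitWord s′
splitWord-cong s≗s′ = tabulate-cong (cong digit ∘ s≗s′)

splitWord-allB : {s : State n} → (∀ x → s x ≡ B) → splitWord s ≡ replicate n 1
splitWord-allB {n} allB = begin
  splitWord _                    ≡⟨ splitWord-cong allB ⟩
  tabulate (λ (_ : Fin n) → 1)   ≡⟨ tabulate-toℕ n (λ _ → 1) ⟩
  applyUpTo (λ _ → 1) n          ≡⟨ applyUpTo-const 1 n ⟩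
  replicate n 1                  ∎
  where open ≡-Reasoning

ASplitsIn : State n → Pred (Fin n) a → Set a
ASplitsIn s P = ∀ x → s x ≡ A → P x

ASplitsIn? : {P : Pred (Fin n) a} → Decidable P → (s : State n) →
             ASplitsIn s P ⊎ ∃ λ x → ¬ P x × s x ≡ A
ASplitsIn? P? s with any? (λ x → ¬? (P? x) ×-dec (s x ≟ₛ A))
... | yes witness = inj₂ witness
... | no none     = inj₁ λ x sx → decidable-stable (P? x) (λ ¬Px → none (x , ¬Px , sx))

ExactlyTwoA : State n → Set
ExactlyTwoA {n} s = Σ (Fin n) λ x → Σ (Fin n) λ y →
  x ≢ y × s x ≡ A × s y ≡ A × ASplitsIn s (λ z → z ≡ x ⊎ z ≡ y)

-- Crossings are addressed by positions c ∈ ℕ taken modulo the number of crossings, so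
-- walks around the annulus need no case split at the wrap.
module Foil {m : ℕ} (s : State (suc m)) where

  at : ℕ → Fin (suc m)
  at c = c mod suc m

  toℕ-at : ∀ c → toℕ (at c) ≡ c % suc m
  toℕ-at c = toℕ-fromℕ< (m%n<n c (suc m))

  at-cong-% : ∀ c d → c % suc m ≡ d % suc m → at c ≡ at d
  at-cong-% c d c≡d = toℕ-injective (trans (toℕ-at c) (trans c≡d (sym (toℕ-at d))))

  at-toℕ : ∀ x → at (toℕ x) ≡ x
  at-toℕ x = toℕ-injective (trans (toℕ-at (toℕ x)) (m<n⇒m%n≡m (toℕ<n x)))

  at-+period : ∀ c → at (c + suc m) ≡ at c
  at-+period c = at-cong-% (c + suc m) c ([m+n]%n≡m%n c (suc m))

  next-at : ∀ c → next (at c) ≡ at (suc c)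
  next-at c = at-cong-% (suc (toℕ (at c))) (suc c) (begin
    suc (toℕ (at c)) % N         ≡⟨ cong (λ v → suc v % N) (toℕ-at c) ⟩
    (1 + c % N) % N              ≡⟨ %-distribˡ-+ 1 (c % N) N ⟩
    (1 % N + c % N % N) % N      ≡⟨ cong (λ v → (1 % N + v) % N) (m%n%n≡m%n c N) ⟩
    (1 % N + c % N) % N          ≡⟨ %-distribˡ-+ 1 c N ⟨
    suc c % N                    ∎)
    where open ≡-Reasoning
          N : ℕ
          N = suc m

  toℕ-next : ∀ i → toℕ (next i) ≡ suc (toℕ i) % suc m
  toℕ-next i = toℕ-fromℕ< (m%n<n (suc (toℕ i)) (suc m))

  A-corner : ∀ {x} sd → s x ≡ A → SameCurve s (x , sd) (x , outer)
  A-corner outer _  = ε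
  A-corner inner sx = bwd (A-right _ sx) ◅ ε

  B-arc : ∀ {i} sd → s (next i) ≡ B → Arc s (i , sd) (next i , sd)
  B-arc outer = B-outer _
  B-arc inner = B-inner _

  B-step : ∀ {c} sd → s (at (suc c)) ≡ B → SameCurve s (at c , sd) (at (suc c) , sd)
  B-step {c} sd sc rewrite sym (next-at c) = fwd (B-arc sd sc) ◅ ε

  ReachesA : Edge (suc m) → Set
  ReachesA e = Σ (Fin (suc m)) λ y → s y ≡ A × SameCurve s e (y , outer)

  reachesA-after : ∀ {a} → s (at a) ≡ A → ∀ d sd → ReachesA (at (d + a) , sd)
  reachesA-after sa zero sd = _ , sa , A-corner sd sa
  reachesA-after {a} sa (suc d) sd with s (at (suc d + a)) in sc
  ... | A = _ , sc , A-corner sd sc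
  ... | B with reachesA-after sa d sd
  ...   | y , sy , c = y , sy , symmetric _ (B-step sd sc) ◅◅ c

  everyEdge-reachesA : ∀ {x} → s x ≡ A → ∀ e → ReachesA e
  everyEdge-reachesA {x} sx (z , sd) =
    subst (λ y → ReachesA (y , sd)) wraps
      (reachesA-after (subst (λ y → s y ≡ A) (sym (at-toℕ x)) sx) (toℕ z + (suc m ∸ toℕ x)) sd)
    where
    open ≡-Reasoning
    wraps : at (toℕ z + (suc m ∸ toℕ x) + toℕ x) ≡ z
    wraps = begin
      at (toℕ z + (suc m ∸ toℕ x) + toℕ x)  ≡⟨ cong at (+-assoc (toℕ z) _ (toℕ x)) ⟩
      at (toℕ z + (suc m ∸ toℕ x + toℕ x))  ≡⟨ cong (λ v → at (toℕ z + v)) (m∸n+n≡m (<⇒≤ (toℕ<n x))) ⟩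
      at (toℕ z + suc m)                    ≡⟨ at-+period (toℕ z) ⟩
      at (toℕ z)                            ≡⟨ at-toℕ z ⟩
      z                                     ∎

  allB-walk : (∀ x → s x ≡ B) → ∀ c sd → SameCurve s (at 0 , sd) (at c , sd)
  allB-walk allB zero    sd = ε
  allB-walk allB (suc c) sd = allB-walk allB c sd ◅◅ B-step sd (allB _)

  allB-side : (∀ x → s x ≡ B) → ∀ {e e′} → SameCurve s e e′ → proj₂ e ≡ proj₂ e′
  allB-side allB = gfold isEquivalence proj₂ arc-side
    where
    arc-side : ∀ {e e′} → Arc s e e′ → proj₂ e ≡ proj₂ e′
    arc-side (A-left i si)  with trans (sym si) (allB _)
    ... | ()
    arc-side (A-right j sj) with trans (sym sj) (allB _)
    ... | ()
    arc-side (B-outer i _)  = refl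
    arc-side (B-inner i _)  = refl

  allB-isTwoState : (∀ x → s x ≡ B) → IsTwoState s
  allB-isTwoState allB =
    (at 0 , outer) , (at 0 , inner) , (λ c → outer≢inner (allB-side allB c)) , λ where
      (z , outer) → inj₁ (toStart z outer)
      (z , inner) → inj₂ (toStart z inner)
    where
    outer≢inner : outer ≢ inner
    outer≢inner ()
    toStart : ∀ z sd → SameCurve s (z , sd) (at 0 , sd)
    toStart z sd = subst (λ y → SameCurve s (y , sd) (at 0 , sd)) (at-toℕ z)
                     (symmetric _ (allB-walk allB (toℕ z) sd))

  A-B-apart : ∀ {x y} → s x ≡ A → s y ≡ B → toℕ x ≢ toℕ y
  A-B-apart sx sy x≡y with trans (sym sx) (trans (cong s (toℕ-injective x≡y)) sy)
  ... | ()

  Between : ℕ → ℕ → Edge (suc m) → Set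
  Between p q (i , _) = p ≤ toℕ i × toℕ i < q

  between-suc : ∀ {p q j j′} → j′ ≡ suc j → p ≢ j′ → q ≢ j′ →
                (p ≤ j × j < q) ⇔ (p ≤ j′ × j′ < q)
  between-suc refl p≢ q≢ =
    mk⇔ (λ (p≤j , j<q) → m≤n⇒m≤1+n p≤j , ≤∧≢⇒< j<q (q≢ ∘ sym))
        (λ (p≤j′ , j′<q) → m<1+n⇒m≤n (≤∧≢⇒< p≤j′ p≢) , <⇒≤ j′<q)

  -- A B-arc moves one position forward, except at the wrap from m to 0, where both ends
  -- lie outside [p, q): q ≤ m, and p ≠ 0 because crossing 0 is a B-split.
  Between-B-arc : ∀ {x y i sd sd′} → s x ≡ A → s y ≡ A → s (next i) ≡ B →
    Between (toℕ x) (toℕ y) (i , sd) ⇔ Between (toℕ x) (toℕ y) (next i , sd′)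
  Between-B-arc {x} {y} {i} sx sy sn with m≤n⇒m<n∨m≡n (m<1+n⇒m≤n (toℕ<n i))
  ... | inj₁ i<m = between-suc (trans (toℕ-next i) (m<n⇒m%n≡m (s≤s i<m)))
                     (A-B-apart sx sn) (A-B-apart sy sn)
  ... | inj₂ i≡m = mk⇔ (λ (_ , i<y) → ⊥-elim (<⇒≢ (ℕ.<-≤-trans i<y (m<1+n⇒m≤n (toℕ<n y))) i≡m))
                       (λ (x≤0 , _) → ⊥-elim (A-B-apart sx sn
                         (trans (ℕ.n≤0⇒n≡0 (subst (toℕ x ≤_) wraps x≤0)) (sym wraps))))
    where wraps : toℕ (next i) ≡ 0
          wraps = trans (toℕ-next i) (trans (cong (λ j → suc j % suc m) i≡m) (n%n≡0 (suc m)))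

  Between-preserved : ∀ {x y e e′} → s x ≡ A → s y ≡ A → SameCurve s e e′ →
    Between (toℕ x) (toℕ y) e ⇔ Between (toℕ x) (toℕ y) e′
  Between-preserved {x} {y} sx sy = gfold ⇔-isEquivalence (Between (toℕ x) (toℕ y)) arc
    where
    arc : ∀ {e e′} → Arc s e e′ → Between (toℕ x) (toℕ y) e ⇔ Between (toℕ x) (toℕ y) e′
    arc (A-left  _ _)  = ⇔-id _
    arc (A-right _ _)  = ⇔-id _
    arc (B-outer _ sn) = Between-B-arc {sd = outer} {outer} sx sy sn
    arc (B-inner _ sn) = Between-B-arc {sd = inner} {inner} sx sy sn

  A-splits-apart : ∀ {x y} → x ≢ y → s x ≡ A → s y ≡ A → ¬ SameCurve s (x , outer) (y , outer)
  A-splits-apart {x} {y} x≢y sx sy c with Fin.<-cmp x y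
  ... | tri< x<y _ _ = ℕ.<-irrefl refl (proj₂ (Equivalence.to (Between-preserved sx sy c) (ℕ.≤-refl , x<y)))
  ... | tri≈ _ x≡y _ = x≢y x≡y
  ... | tri> _ _ y<x = ℕ.<-irrefl refl (proj₂ (Equivalence.to (Between-preserved sy sx (symmetric _ c)) (ℕ.≤-refl , y<x)))

  everyEdge-reaches-A-in : ∀ {x} {P : Pred (Fin (suc m)) a} → s x ≡ A → ASplitsIn s P → ∀ e →
    Σ (Fin (suc m)) λ y → P y × SameCurve s e (y , outer)
  everyEdge-reaches-A-in sx inP e with everyEdge-reachesA sx e
  ... | y , sy , c = y , inP y sy , c

  oneA-notTwoState : ∀ {x} → s x ≡ A → ASplitsIn s (_≡ x) → ¬ IsTwoState s
  oneA-notTwoState {x} sx onlyX (u , v , u≁v , _) = u≁v (toX u ◅◅ symmetric _ (toX v))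
    where
    toX : ∀ e → SameCurve s e (x , outer)
    toX e with everyEdge-reaches-A-in sx onlyX e
    ... | _ , refl , c = c

  exactlyTwoA-isTwoState : ExactlyTwoA s → IsTwoState s
  exactlyTwoA-isTwoState (x , y , x≢y , sx , sy , onlyXY) =
    (x , outer) , (y , outer) , A-splits-apart x≢y sx sy , toXY
    where
    toXY : ∀ e → SameCurve s e (x , outer) ⊎ SameCurve s e (y , outer)
    toXY e with everyEdge-reaches-A-in sx onlyXY e
    ... | _ , inj₁ refl , c = inj₁ c
    ... | _ , inj₂ refl , c = inj₂ c

  threeA-notTwoState : ∀ {x y z} → x ≢ y → y ≢ z → x ≢ z → s x ≡ A → s y ≡ A → s z ≡ A →
                       ¬ IsTwoState s
  threeA-notTwoState x≢y y≢z x≢z sx sy sz (_ , _ , _ , cover) =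
    no-three-apart-in-two-classes (EqClosure.setoid (Arc s)) (cover _) (cover _) (cover _)
      (A-splits-apart x≢y sx sy) (A-splits-apart y≢z sy sz) (A-splits-apart x≢z sx sz)

  classify : IsTwoState s → (∀ x → s x ≡ B) ⊎ ExactlyTwoA s
  classify two with ASplitsIn? {P = λ _ → ⊥} (λ _ → no id) s
  ... | inj₁ noA = inj₁ λ x → ≢A⇒≡B (noA x)
  ... | inj₂ (x , _ , sx) with ASplitsIn? (Fin._≟ x) s
  ...   | inj₁ onlyX = ⊥-elim (oneA-notTwoState sx onlyX two)
  ...   | inj₂ (y , y≢x , sy) with ASplitsIn? (λ z → z Fin.≟ x ⊎-dec z Fin.≟ y) s
  ...     | inj₁ onlyXY = inj₂ (x , y , y≢x ∘ sym , sx , sy , onlyXY)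
  ...     | inj₂ (z , z∉ , sz) =
    ⊥-elim (threeA-notTwoState (y≢x ∘ sym) (z∉ ∘ inj₂ ∘ sym) (z∉ ∘ inj₁ ∘ sym) sx sy sz two)

  isTwoState⇔ : IsTwoState s ⇔ ((∀ x → s x ≡ B) ⊎ ExactlyTwoA s)
  isTwoState⇔ = mk⇔ classify Sum.[ allB-isTwoState , exactlyTwoA-isTwoState ]

single : ℕ → ℕ → Split
single zero    zero    = A
single zero    (suc _) = B
single (suc k) zero    = B
single (suc k) (suc c) = single k c

-- A-splits exactly at p and p + suc k (mark-A⇔); recursive so that its split word
-- computes.
mark : ℕ → ℕ → ℕ → Split
mark zero    k zero    = A
mark zero    k (suc c) = single k c
mark (suc p) k zero    = B
mark (suc p) k (suc c) = mark p k c

marked : ℕ → ℕ → State n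
marked p k x = mark p k (toℕ x)

single-A⇔ : ∀ k c → single k c ≡ A ⇔ c ≡ k
single-A⇔ k c = mk⇔ (to k c) (λ { refl → self k })
  where
  to : ∀ k c → single k c ≡ A → c ≡ k
  to zero    zero    _  = refl
  to (suc k) (suc c) sA = cong suc (to k c sA)
  self : ∀ k → single k k ≡ A
  self zero    = refl
  self (suc k) = self k

mark-A⇔ : ∀ p k c → mark p k c ≡ A ⇔ (c ≡ p ⊎ c ≡ p + suc k)
mark-A⇔ zero    k zero    = mk⇔ (λ _ → inj₁ refl) (λ _ → refl)
mark-A⇔ zero    k (suc c) = mk⇔ (inj₂ ∘ cong suc ∘ Equivalence.to (single-A⇔ k c))
                                 Sum.[ (λ ()) , Equivalence.from (single-A⇔ k c) ∘ ℕ.suc-injective ]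
mark-A⇔ (suc p) k zero    = mk⇔ (λ ()) Sum.[ (λ ()) , (λ ()) ]
mark-A⇔ (suc p) k (suc c) = mk⇔ (Sum.map (cong suc) (cong suc) ∘ Equivalence.to (mark-A⇔ p k c))
                                 (Equivalence.from (mark-A⇔ p k c) ∘ Sum.map ℕ.suc-injective ℕ.suc-injective)

marked-A⇔ : ∀ {p k} {x y z : Fin n} → toℕ x ≡ p → toℕ y ≡ p + suc k →
            marked p k z ≡ A ⇔ (z ≡ x ⊎ z ≡ y)
marked-A⇔ {p = p} {k} {x} {y} {z} refl y≡ = mk⇔
  (Sum.map toℕ-injective (λ z≡ → toℕ-injective (trans z≡ (sym y≡))) ∘ Equivalence.to (mark-A⇔ p k (toℕ z)))
  (Equivalence.from (mark-A⇔ p k (toℕ z)) ∘ Sum.map (cong toℕ) (λ { refl → y≡ }))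

applyUpTo-single : ∀ k r → applyUpTo (digit ∘ single k) (k + suc r) ≡ replicate k 1 ++ (0 ∷ replicate r 1)
applyUpTo-single zero    r = cong (0 ∷_) (applyUpTo-const 1 r)
applyUpTo-single (suc k) r = cong (1 ∷_) (applyUpTo-single k r)

applyUpTo-mark : ∀ p k r → applyUpTo (digit ∘ mark p k) (p + suc (k + suc r)) ≡
                           replicate p 1 ++ (0 ∷ replicate k 1 ++ (0 ∷ replicate r 1))
applyUpTo-mark zero    k r = cong (0 ∷_) (applyUpTo-single k r)
applyUpTo-mark (suc p) k r = cong (1 ∷_) (applyUpTo-mark p k r)

length-split : ∀ {n p k} → p + suc k < n → n ≡ p + suc (k + suc (n ∸ p ∸ k ∸ 2))
length-split {n} {p} {k} lt = begin
  n                                  ≡⟨ m+[n∸m]≡n (subst (_≤ n) (two-marks p k) lt) ⟨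
  p + k + 2 + (n ∸ (p + k + 2))      ≡⟨ cong (p + k + 2 +_) exponent ⟨
  p + k + 2 + (n ∸ p ∸ k ∸ 2)        ≡⟨ rearrange p k (n ∸ p ∸ k ∸ 2) ⟩
  p + suc (k + suc (n ∸ p ∸ k ∸ 2))  ∎
  where
  open ≡-Reasoning
  two-marks : ∀ p k → suc (p + suc k) ≡ p + k + 2
  two-marks = solve-∀
  rearrange : ∀ p k r → p + k + 2 + r ≡ p + suc (k + suc r)
  rearrange = solve-∀
  exponent : n ∸ p ∸ k ∸ 2 ≡ n ∸ (p + k + 2)
  exponent = trans (cong (_∸ 2) (∸-+-assoc n p k)) (∸-+-assoc n (p + k) 2)

splitWord-marked : ∀ {n p k} → p + suc k < n →
  splitWord (marked {n} p k) ≡ replicate p 1 ++ (0 ∷ replicate k 1 ++ (0 ∷ replicate (n ∸ p ∸ k ∸ 2) 1))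
splitWord-marked {n} {p} {k} lt = begin
  splitWord (marked {n} p k)                           ≡⟨ tabulate-toℕ n (digit ∘ mark p k) ⟩
  applyUpTo (digit ∘ mark p k) n                       ≡⟨ cong (applyUpTo (digit ∘ mark p k)) (length-split lt) ⟩
  applyUpTo (digit ∘ mark p k) (p + suc (k + suc r))   ≡⟨ applyUpTo-mark p k r ⟩
  replicate p 1 ++ (0 ∷ replicate k 1 ++ (0 ∷ replicate r 1)) ∎
  where
  open ≡-Reasoning
  r : ℕ
  r = n ∸ p ∸ k ∸ 2

marked-exactlyTwoA : ∀ {n p k} → p + suc k < n → ExactlyTwoA (marked {n} p k)
marked-exactlyTwoA {n} {p} {k} lt =
  x , y , x≢y , marks x (inj₁ refl) , marks y (inj₂ refl) , λ z → Equivalence.to (marks⇔ z)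
  where
  p<p+1+k : p < p + suc k
  p<p+1+k = ℕ.m<m+n p ℕ.z<s
  x y : Fin n
  x = fromℕ< (ℕ.<-trans p<p+1+k lt)
  y = fromℕ< lt
  x≢y : x ≢ y
  x≢y x≡y = <⇒≢ p<p+1+k (trans (sym (toℕ-fromℕ< _)) (trans (cong toℕ x≡y) (toℕ-fromℕ< lt)))
  marks⇔ : ∀ z → marked p k z ≡ A ⇔ (z ≡ x ⊎ z ≡ y)
  marks⇔ z = marked-A⇔ (toℕ-fromℕ< _) (toℕ-fromℕ< lt)
  marks : ∀ z → z ≡ x ⊎ z ≡ y → marked p k z ≡ A
  marks z = Equivalence.from (marks⇔ z)

ordered⇒marked : ∀ {s : State n} {x y} → toℕ x < toℕ y → s x ≡ A → s y ≡ A →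
  ASplitsIn s (λ z → z ≡ x ⊎ z ≡ y) →
  Σ ℕ λ p → Σ ℕ λ k → p + suc k < n × s ≗ marked p k
ordered⇒marked {s = s} {x} {y} x<y sx sy onlyXY =
  toℕ x , k , subst (_< _) (sym second) (toℕ<n y) , λ z →
    ≡A-ext (Equivalence.from (marks z) ∘ onlyXY z)
           (Sum.[ (λ { refl → sx }) , (λ { refl → sy }) ] ∘ Equivalence.to (marks z))
  where
  k : ℕ
  k = toℕ y ∸ suc (toℕ x)
  second : toℕ x + suc k ≡ toℕ y
  second = trans (+-suc (toℕ x) k) (m+[n∸m]≡n x<y)
  marks : ∀ z → marked (toℕ x) k z ≡ A ⇔ (z ≡ x ⊎ z ≡ y)
  marks z = marked-A⇔ refl (sym second)

exactlyTwoA⇒marked : {s : State n} → ExactlyTwoA s → Σ ℕ λ p → Σ ℕ λ k → p + suc k < n × s ≗ marked p k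
exactlyTwoA⇒marked (x , y , x≢y , sx , sy , onlyXY) with Fin.<-cmp x y
... | tri< x<y _ _ = ordered⇒marked x<y sx sy onlyXY
... | tri≈ _ x≡y _ = ⊥-elim (x≢y x≡y)
... | tri> _ _ y<x = ordered⇒marked y<x sy sx (λ z → Sum.swap ∘ onlyXY z)

second-mark-inside⇔ : ∀ {n p k} → 2 ≤ n → (p ≤ n ∸ 2 × k ≤ n ∸ p ∸ 2) ⇔ p + suc k < n
second-mark-inside⇔ {n} {p} {k} 2≤n = mk⇔
  (λ (p≤ , k≤) → subst (_≤ n) (sym (two-marks p k))
     (m≤o∸n⇒m+n≤o k (m≤o∸n⇒m+n≤o p 2≤n p≤) (subst (k ≤_) (∸-+-assoc n p 2) k≤)))
  (λ lt → let k+p+2≤n = subst (_≤ n) (two-marks p k) lt in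
     m+n≤o⇒m≤o∸n p (ℕ.≤-trans (m≤n+m (p + 2) k) k+p+2≤n) ,
     subst (k ≤_) (sym (∸-+-assoc n p 2)) (m+n≤o⇒m≤o∸n k k+p+2≤n))
  where
  two-marks : ∀ p k → suc (p + suc k) ≡ k + (p + 2)
  two-marks = solve-∀

corollary24 : (n : ℕ) → 2 ≤ n → (w : List ℕ) →
    SplitWordOf2State n w ⇔
      ((Σ ℕ λ p → Σ ℕ λ k → p ≤ n ∸ 2 × k ≤ n ∸ p ∸ 2 ×
          w ≡ replicate p 1 ++ (0 ∷ replicate k 1 ++ (0 ∷ replicate (n ∸ p ∸ k ∸ 2) 1)))
       ⊎ w ≡ replicate n 1)
corollary24 n@(suc _) 2≤n w = mk⇔ to from
  where
  Words : Set
  Words = (Σ ℕ λ p → Σ ℕ λ k → p ≤ n ∸ 2 × k ≤ n ∸ p ∸ 2 ×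
             w ≡ replicate p 1 ++ (0 ∷ replicate k 1 ++ (0 ∷ replicate (n ∸ p ∸ k ∸ 2) 1)))
          ⊎ w ≡ replicate n 1

  to : SplitWordOf2State n w → Words
  to (s , two , refl) with Equivalence.to (Foil.isTwoState⇔ s) two
  ... | inj₁ allB = inj₂ (splitWord-allB allB)
  ... | inj₂ twoA with exactlyTwoA⇒marked twoA
  ...   | p , k , inside , s≗marked with Equivalence.from (second-mark-inside⇔ 2≤n) inside
  ...     | p≤ , k≤ = inj₁ (p , k , p≤ , k≤ , trans (splitWord-cong s≗marked) (splitWord-marked inside))

  from : Words → SplitWordOf2State n w
  from (inj₂ refl) =
    (λ _ → B) , Equivalence.from (Foil.isTwoState⇔ _) (inj₁ λ _ → refl) , splitWord-allB λ _ → refl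
  from (inj₁ (p , k , p≤ , k≤ , refl)) =
    marked p k , Equivalence.from (Foil.isTwoState⇔ _) (inj₂ (marked-exactlyTwoA inside)) ,
    splitWord-marked inside
    where
    inside : p + suc k < n
    inside = Equivalence.to (second-mark-inside⇔ 2≤n) (p≤ , k≤)
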